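{- Let $I$ be an instance of $\textsc{MinSumC}$ in which every program has cost $c_1$ or $c_2$, where $c_1<c_2$ are non-negative integers, and every agent has a nonempty preference list. Run the algorithm described in the context on $I$. Then the matching $M$ maintained by the algorithm is envy-free at every point of its execution.
   Context: $\textsc{MinSumC}$ instance: a finite set $\mathcal{A}$ of agents, a finite set $\mathcal{P}$ of programs, a set $E\subseteq \mathcal{A}\times\mathcal{P}$ of mutually acceptable pairs; $\mathcal{N}(a)=\{p:(a,p)\in E\}$, $\mathcal{N}(p)=\{a:(a,p)\in E\}$. Each agent $a$ has a strict preference order $\succ_a$ on $\mathcal{N}(a)$, each program $p$ a strict preference order $\succ_p$ on $\mathcal{N}(p)$, and each program a non-negative integer cost $c(p)$ (initial quotas are $0$, so programs have no capacity limits). A matching is a set $M\subseteq E$ in which every agent occurs in at most one pair; $M(a)$ is $a$'s partner or $\bot$ if unmatched, and every $p\in\mathcal{N}(a)$ satisfies $p\succ_a\bot$. $M$ is envy-free if there are no $(a,p)\in M$ and $a'\in\mathcal{N}(p)$ with $a'\succ_p a$ and $p\succ_{a'}M(a')$. $M$ is $\mathcal{A}$-perfect if every agent is matched. Its cost is $c(M)=\sum_{(a,p)\in M}c(p)$. Dual variables: $y_a$ for each agent $a$, and $z_{a',p,a}\ge 0$ for each valid triplet $(a',p,a)$, i.e. $(a',p),(a,p)\in E$ with $a'\succ_p a$. For $(a,p)\in E$ let $\mathrm{lhs}(a,p)=y_a+\sum_{p'\in\mathcal{N}(a):\,p'=p\text{ or }p\succ_a p'}\ \sum_{a''\in\mathcal{N}(p'):\,a\succ_{p'}a''}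 z_{a,p',a''}-\sum_{a''\in\mathcal{N}(p):\,a''\succ_p a} z_{a'',p,a}$, $slack(a,p)=c(p)-\mathrm{lhs}(a,p)$; $(a,p)$ is tight if $slack(a,p)=0$. For the current matching $M$, $thresh(p)$ is the $\succ_p$-most-preferred agent $a\in\mathcal{N}(p)$ with $p\succ_a M(a)$, or $\bot$ if none. An edge $(a,p)\notin M$ is matchable if it is tight and $a=thresh(p)$. Free-promotions routine: while some matchable edge $(b,q)$ exists, remove $b$'s edge from $M$ (if any), add $(b,q)$, and recompute all thresholds. Algorithm: (1) $M=\emptyset$, all $y_a=c_1$, all $z=0$. (2) For each agent $a$ having a cost-$c_1$ program in $\mathcal{N}(a)$, add $(a,p)$ to $M$ where $p$ is $a$'s most-preferred cost-$c_1$ program. (3) Compute thresholds. (4) While $M$ is not $\mathcal{A}$-perfect: pick an unmatched agent $a$; while $a$ is unmatched: set $y_a\leftarrow y_a+c_2-c_1$; if a matchable edge is incident on $a$, add $a$'s most-preferred matchable edge to $M$, run free-promotions and recompute thresholds; otherwise let $\mathcal{P}(a)=\{p\in\mathcal{N}(a): p\succ_a M(a),\ (a,p)\text{ tight},\ thresh(p)\ne a\}$ and while $\mathcal{P}(a)\neq\emptyset$: choose an agent $a'$ that is the threshold of some program in $\mathcal{P}(a)$, let $\mathcal{P}(a,a')$ be the programs of $\mathcal{P}(a)$ with threshold $a'$, let $p$ be $a'$'s least-preferred program in $\mathcal{P}(a,a')$, set $z_{a',p,a}=c_2-c_1$, let $(a',p')$ be the most-preferred matchable edge incident on $a'$, unmatch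 $a'$ if matched and add $(a',p')$ to $M$, run free-promotions, recompute thresholds and $\mathcal{P}(a)$. (5) Return $M$. -}

module Defs where

open import Data.Nat using (ℕ; zero; suc; _+_; _∸_; _<_; _<ᵇ_)
open import Data.Integer using (ℤ; +_) renaming (_+_ to _+ℤ_; _-_ to _-ℤ_)
open import Data.Fin using (Fin; zero; suc; _≟_)
open import Data.Bool using (Bool; true; false; if_then_else_; _∧_; _∨_)
open import Data.Maybe using (Maybe; just; nothing)
open import Data.Product using (Σ; ∃; _×_; _,_)
open import Data.Sum using (_⊎_)
open import Data.Unit using (⊤)
open import Relation.Nullary using (¬_)
open import Relation.Nullary.Decidable using (⌊_⌋)
open import Relation.Binary.PropositionalEquality using (_≡_; _≢_)
open import Relation.Binary.Construct.Closure.ReflexiveTransitive using (Star)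

sumFin : ∀ {n} → (Fin n → ℕ) → ℕ
sumFin {zero}  f = 0
sumFin {suc n} f = f zero + sumFin (λ i → f (suc i))

guard : Bool → ℕ → ℕ
guard b x = if b then x else 0

-- A MinSumC instance (initial quotas 0, i.e. no capacities).
-- Agents are Fin nA, programs Fin nP.  acc a p = true iff (a,p) ∈ E.
-- Strict preferences are given by ranks (smaller rank = more preferred),
-- injective on the relevant neighbourhood, so they are strict total orders
-- on N(a) resp. N(p).

record Instance : Set where
  field
    nA nP     : ℕ
    acc       : Fin nA → Fin nP → Bool
    rankA     : Fin nA → Fin nP → ℕ
    rankP     : Fin nP → Fin nA → ℕ
    rankA-inj : ∀ a p q → acc a p ≡ true → acc a q ≡ true →
                rankA a p ≡ rankA a q → p ≡ q
    rankP-inj : ∀ p a b → acc a p ≡ true → acc b p ≡ true →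
                rankP p a ≡ rankP p b → a ≡ b
    cost      : Fin nP → ℕ

module _ (I : Instance) where
  open Instance I

  Agent = Fin nA
  Program = Fin nP

  Matching : Set
  Matching = Agent → Maybe Program

  PrefOver : Agent → Program → Maybe Program → Set
  PrefOver a p nothing  = ⊤
  PrefOver a p (just q) = rankA a p < rankA a q

  EnvyFree : Matching → Set
  EnvyFree M = ∀ a p a' → M a ≡ just p → acc a' p ≡ true →
               rankP p a' < rankP p a → ¬ PrefOver a' p (M a')

  APerfect : Matching → Set
  APerfect M = ∀ a → ∃ λ p → M a ≡ just p

  assign : Matching → Agent → Program → Matching
  assign M a p b = if ⌊ b ≟ a ⌋ then just p else M b

  -- dual variables
  Yvec : Set
  Yvec = Agent → ℤ

  Zvec : Set
  Zvec = Agent → Program → Agent → ℕ   -- z_{a',p,a} (only valid triplets matter)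

  lhs : Yvec → Zvec → Agent → Program → ℤ
  lhs y z a p =
    (y a +ℤ + sumFin (λ p' →
        guard (acc a p' ∧ (⌊ p' ≟ p ⌋ ∨ (rankA a p <ᵇ rankA a p')))
          (sumFin (λ a'' → guard (acc a'' p' ∧ (rankP p' a <ᵇ rankP p' a''))
                                 (z a p' a'')))))
    -ℤ + sumFin (λ a'' → guard (acc a'' p ∧ (rankP p a'' <ᵇ rankP p a))
                               (z a'' p a))

  Tight : Yvec → Zvec → Agent → Program → Set
  Tight y z a p = lhs y z a p ≡ + cost p

  IsThresh : Matching → Program → Agent → Set
  IsThresh M p a =
    acc a p ≡ true × PrefOver a p (M a) ×
    (∀ a' → acc a' p ≡ true → PrefOver a' p (M a') →
            a' ≡ a ⊎ rankP p a < rankP p a')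

  Matchable : Matching → Yvec → Zvec → Agent → Program → Set
  Matchable M y z a p =
    acc a p ≡ true × M a ≢ just p × Tight y z a p × IsThresh M p a

  MostPrefMatchable : Matching → Yvec → Zvec → Agent → Program → Set
  MostPrefMatchable M y z a p =
    Matchable M y z a p ×
    (∀ q → Matchable M y z a q → q ≡ p ⊎ rankA a p < rankA a q)

  InP : Matching → Yvec → Zvec → Agent → Program → Set
  InP M y z a p =
    acc a p ≡ true × PrefOver a p (M a) × Tight y z a p × ¬ IsThresh M p a

  module Algo (c₁ c₂ : ℕ) where

    δ : ℕ
    δ = c₂ ∸ c₁

    InitMatching : Matching → Set
    InitMatching M = ∀ a →
      (M a ≡ nothing × (∀ p → acc a p ≡ true → cost p ≢ c₁)) ⊎
      (Σ Program λ p → M a ≡ just p × acc a p ≡ true × cost p ≡ c₁ ×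
         (∀ q → acc a q ≡ true → cost q ≡ c₁ → q ≡ p ⊎ rankA a p < rankA a q))

    incY : Yvec → Agent → Yvec
    incY y a b = if ⌊ b ≟ a ⌋ then y b +ℤ + δ else y b

    setZ : Zvec → Agent → Program → Agent → Zvec
    setZ z a' p a b q c =
      if ⌊ b ≟ a' ⌋ ∧ ⌊ q ≟ p ⌋ ∧ ⌊ c ≟ a ⌋ then δ else z b q c

    -- control points of the algorithm
    data Phase : Set where
      start : Phase                 -- after step (1)
      outer : Phase                 -- test of the loop of step (4)
      inner : Agent → Phase         -- body of "while a is unmatched"
      ploop : Agent → Phase         -- test of "while 𝒫(a) ≠ ∅"
      check : Agent → Phase         -- test of "while a is unmatched"
      promo : Phase → Phase         -- running free promotions, then continue
      done  : Phase                 -- step (5)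

    record State : Set where
      constructor st
      field
        phase : Phase
        M     : Matching
        y     : Yvec
        z     : Zvec

    initState : State
    initState = st start (λ _ → nothing) (λ _ → + c₁) (λ _ _ _ → 0)

    data Step : State → State → Set where
      init       : ∀ {M y z M'} → InitMatching M' →
                   Step (st start M y z) (st outer M' y z)
      outer-pick : ∀ {M y z} a → M a ≡ nothing →
                   Step (st outer M y z) (st (inner a) M y z)
      outer-done : ∀ {M y z} → APerfect M →
                   Step (st outer M y z) (st done M y z)
      inner-match : ∀ {M y z} a p → MostPrefMatchable M (incY y a) z a p →
                   Step (st (inner a) M y z)
                        (st (promo (check a)) (assign M a p) (incY y a) z)
      inner-nomatch : ∀ {M y z} a → (∀ p → ¬ Matchable M (incY y a) z a p) →
                   Step (st (inner a) M y z) (st (ploop a) M (incY y a) z)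
      promo-step : ∀ {k M y z} b q → Matchable M y z b q →
                   Step (st (promo k) M y z) (st (promo k) (assign M b q) y z)
      promo-end  : ∀ {k M y z} → (∀ b q → ¬ Matchable M y z b q) →
                   Step (st (promo k) M y z) (st k M y z)
      ploop-step : ∀ {M y z} a a' p p' →
                   InP M y z a p → IsThresh M p a' →
                   (∀ q → InP M y z a q → IsThresh M q a' →
                          q ≡ p ⊎ rankA a' q < rankA a' p) →
                   MostPrefMatchable M y (setZ z a' p a) a' p' →
                   Step (st (ploop a) M y z)
                        (st (promo (ploop a)) (assign M a' p') y (setZ z a' p a))
      ploop-end  : ∀ {M y z} a → (∀ p → ¬ InP M y z a p) →
                   Step (st (ploop a) M y z) (st (check a) M y z)
      check-unmatched : ∀ {M y z} a → M a ≡ nothing →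
                   Step (st (check a) M y z) (st (inner a) M y z)
      check-matched : ∀ {M y z} a → M a ≢ nothing →
                   Step (st (check a) M y z) (st outer M y z)

    Reachable : State → Set
    Reachable s = Star Step initState s

{-# OPTIONS --safe #-}
-- The matching changes only in two ways: step (2) builds it from scratch, and every
-- later step moves some agent a to a program p of which a is the threshold.  The
-- initial matching is envy-free because an agent envying at a cost-c₁ program would
-- itself hold a cost-c₁ program it likes at least as much.  A move to a threshold
-- program only improves a's partner, so it creates no envy towards other agents'
-- programs, and no agent can envy a at p, since such an agent would outrank the
-- threshold a of p.
module Submission where

open import Defs
open import Data.Nat using (ℕ; _<_)
open import Data.Bool using (true)
open import Data.Product using (∃)
open import Data.Sum using (_⊎_)
open import Relation.Binary.PropositionalEquality using (_≡_)

open import Data.Fin using (_≟_)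
open import Data.Maybe using (Maybe; just; nothing)
open import Data.Maybe.Properties using (just-injective)
open import Data.Nat.Properties using (<-irrefl; <-asym; <-trans)
open import Data.Product using (_,_)
open import Data.Sum using (inj₁; inj₂)
open import Data.Unit using (tt)
open import Function using (id; _∘_)
open import Relation.Binary.Construct.Closure.ReflexiveTransitive using (Star; fold)
open import Relation.Binary.PropositionalEquality using (refl; sym; trans; subst)
open import Relation.Nullary using (yes; no)

module _ (I : Instance) where
  open Instance I

  PrefOver-trans : ∀ a {p q} (m : Maybe (Program I)) →
                   rankA a q < rankA a p → PrefOver I a p m → PrefOver I a q m
  PrefOver-trans _ nothing  _   _   = tt
  PrefOver-trans _ (just _) q≻p p≻m = <-trans q≻p p≻m

  PrefOver-assign⇒PrefOver : ∀ (M : Matching I) {a p} → PrefOver I a p (M a) →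
                             ∀ b q → PrefOver I b q (assign I M a p b) → PrefOver I b q (M b)
  PrefOver-assign⇒PrefOver M {a} p≻Ma b q q≻M'b with b ≟ a
  ... | yes refl = PrefOver-trans b (M b) q≻M'b p≻Ma
  ... | no  _    = q≻M'b

  EnvyFree-assign : ∀ (M : Matching I) {a p} → IsThresh I M p a →
                    EnvyFree I M → EnvyFree I (assign I M a p)
  EnvyFree-assign M {a} (_ , p≻Ma , thresh) envyFree b q a' M'b≡q a'∈q a'≻b q≻M'a'
    with b ≟ a
  ... | no _ = envyFree b q a' M'b≡q a'∈q a'≻b (PrefOver-assign⇒PrefOver M p≻Ma a' q q≻M'a')
  ... | yes refl with just-injective M'b≡q
  ...   | refl with thresh a' a'∈q (PrefOver-assign⇒PrefOver M p≻Ma a' q q≻M'a')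
  ...     | inj₁ refl = <-irrefl refl a'≻b
  ...     | inj₂ b≻a' = <-asym b≻a' a'≻b

  module _ (c₁ c₂ : ℕ) where
    open Algo I c₁ c₂

    InitMatching⇒cost≡c₁ : ∀ {M} → InitMatching M → ∀ {a p} → M a ≡ just p → cost p ≡ c₁
    InitMatching⇒cost≡c₁ isInit {a} Ma≡p with isInit a
    ... | inj₁ (Ma≡nothing , _) with trans (sym Ma≡nothing) Ma≡p
    ...   | ()
    InitMatching⇒cost≡c₁ isInit Ma≡p | inj₂ (_ , Ma≡p₀ , _ , cost-p₀ , _)
      with just-injective (trans (sym Ma≡p₀) Ma≡p)
    ... | refl = cost-p₀

    EnvyFree-init : ∀ M → InitMatching M → EnvyFree I M
    EnvyFree-init M isInit a p a' Ma≡p a'∈p a'≻a p≻Ma'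
      with isInit a' | InitMatching⇒cost≡c₁ isInit Ma≡p
    ... | inj₁ (_ , no-c₁-program) | cost-p = no-c₁-program p a'∈p cost-p
    ... | inj₂ (q , Ma'≡q , _ , _ , best) | cost-p
      with best p a'∈p cost-p | subst (PrefOver I a' p) Ma'≡q p≻Ma'
    ...   | inj₁ refl | p≻p = <-irrefl refl p≻p
    ...   | inj₂ q≻p  | p≻q = <-asym q≻p p≻q

    EnvyFree-step : ∀ {s t} → Step s t → EnvyFree I (State.M s) → EnvyFree I (State.M t)
    EnvyFree-step (init isInit) _                                         = EnvyFree-init _ isInit
    EnvyFree-step (outer-pick _ _)                                        = id
    EnvyFree-step (outer-done _)                                          = id
    EnvyFree-step (inner-match _ _ ((_ , _ , _ , thresh) , _))            = EnvyFree-assign _ thresh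
    EnvyFree-step (inner-nomatch _ _)                                     = id
    EnvyFree-step (promo-step _ _ (_ , _ , _ , thresh))                   = EnvyFree-assign _ thresh
    EnvyFree-step (promo-end _)                                           = id
    EnvyFree-step (ploop-step _ _ _ _ _ _ _ ((_ , _ , _ , thresh) , _))   = EnvyFree-assign _ thresh
    EnvyFree-step (ploop-end _ _)                                         = id
    EnvyFree-step (check-unmatched _ _)                                   = id
    EnvyFree-step (check-matched _ _)                                     = id

    EnvyFree-initState : EnvyFree I (State.M initState)
    EnvyFree-initState _ _ _ ()

    EnvyFree-Star : ∀ {s t} → Star Step s t → EnvyFree I (State.M s) → EnvyFree I (State.M t)
    EnvyFree-Star = fold (λ s t → EnvyFree I (State.M s) → EnvyFree I (State.M t))
                         (λ step rest → rest ∘ EnvyFree-step step) id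

mainTheorem1 : (I : Instance) (c₁ c₂ : ℕ) → c₁ < c₂ →
    (∀ p → Instance.cost I p ≡ c₁ ⊎ Instance.cost I p ≡ c₂) →
    (∀ a → ∃ λ p → Instance.acc I a p ≡ true) →
    ∀ s → Algo.Reachable I c₁ c₂ s → EnvyFree I (Algo.State.M {I} {c₁} {c₂} s)
mainTheorem1 I c₁ c₂ _ _ _ _ reachable =
  EnvyFree-Star I c₁ c₂ reachable (EnvyFree-initState I c₁ c₂)
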